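{- Let $(L;\leq,\cdot,\rightarrow,',0,1)$ be a system in which $(L;\leq,',0,1)$ is a bounded involutive lattice, $\cdot$ and $\rightarrow$ are binary operations on $L$, and for all $a,b,c\in L$: (cw1) $a\cdot b=(a\rightarrow b')'$; (cw2) if $a\leq b'$ then $a'\rightarrow b=b'\rightarrow a$ and $a\leq a'\rightarrow b$; (cw3) if $a\leq b'$ and $a\leq c'$, then $a'\rightarrow b\leq c'$ implies $a'\rightarrow c\leq b'$; (cw4) if $b'\leq c$ and $a'\leq b\cdot c$ then $a\cdot(b\cdot c)=(a\cdot b)\cdot c$; (cw5) $a\cdot 1=a$. Define the partial operation $\oplus$ by $a\oplus b=a'\rightarrow b$ whenever $a\leq b'$, and undefined otherwise. Then $(L;\leq,\oplus,',0,1)$ is a weak lattice effect algebra.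
   Context: A bounded involutive lattice is a structure $(L;\leq,',0,1)$ where $(L;\leq,0,1)$ is a bounded lattice and $'$ is a unary operation with $a''=a$ and $a\leq b\Rightarrow b'\leq a'$. A weak lattice effect algebra is a bounded involutive lattice $(L;\leq,\oplus,',0,1)$ with a partial binary operation $\oplus$ such that $a\oplus b$ is defined if and only if $a\leq b'$, and: (W1) if $a\oplus b$ is defined then $a\oplus b=b\oplus a$; (W2) if $b\oplus c$ and $a\oplus(b\oplus c)$ are defined then $a\oplus b$ and $(a\oplus b)\oplus c$ are defined and $a\oplus(b\oplus c)=(a\oplus b)\oplus c$; (W3) $a\oplus 0=a$ for all $a$. -}

module Defs where

open import Level using (Level; _⊔_; suc)
open import Data.Product using (_×_)
open import Relation.Binary.PropositionalEquality using (_≡_)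
open import Relation.Binary.Lattice.Structures using (IsBoundedLattice)

record BoundedInvolutiveLattice (c ℓ : Level) : Set (suc (c ⊔ ℓ)) where
  infix 4 _≤_
  infixr 6 _∨_
  infixr 7 _∧_
  infix 9 _′
  field
    Carrier : Set c
    _≤_     : Carrier → Carrier → Set ℓ
    _∨_     : Carrier → Carrier → Carrier
    _∧_     : Carrier → Carrier → Carrier
    𝟙       : Carrier
    𝟘       : Carrier
    isBoundedLattice : IsBoundedLattice _≡_ _≤_ _∨_ _∧_ 𝟙 𝟘
    _′      : Carrier → Carrier
    involutive : ∀ a → (a ′) ′ ≡ a
    antitone   : ∀ {a b} → a ≤ b → b ′ ≤ a ′

-- The partial operation ⊕ is represented by a total function whose values are
-- only relevant on its domain: a ⊕ b is defined iff a ≤ b ′.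
record IsWeakLatticeEffectAlgebra {c ℓ : Level} (L : BoundedInvolutiveLattice c ℓ)
       (_⊕_ : BoundedInvolutiveLattice.Carrier L → BoundedInvolutiveLattice.Carrier L
              → BoundedInvolutiveLattice.Carrier L) : Set (c ⊔ ℓ) where
  open BoundedInvolutiveLattice L
  field
    W1 : ∀ a b → a ≤ b ′ → (b ≤ a ′) × (a ⊕ b ≡ b ⊕ a)
    W2 : ∀ a b c → b ≤ c ′ → a ≤ (b ⊕ c) ′ →
         (a ≤ b ′) × ((a ⊕ b) ≤ c ′) × (a ⊕ (b ⊕ c) ≡ (a ⊕ b) ⊕ c)
    W3 : ∀ a → (a ≤ 𝟘 ′) × (a ⊕ 𝟘 ≡ a)

module Submission where

-- Write  a ⊕ b = a′ ⇒ b.  By (cw1) and involutivity this is the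
-- De Morgan dual of the product:  (a ⊕ b)′ = a′ · b′.  The three axioms of a
-- weak lattice effect algebra are then checked one by one:
--   (W1) commutativity is literally the first half of (cw2), and definedness
--        of b ⊕ a follows from a ≤ b′ by antitonicity of ′;
--   (W3) a ⊕ 0 = (a′ · 1)′ = a by (cw5), using 0′ = 1;
--   (W2) a ≤ b′ holds because b ≤ b ⊕ c (second half of (cw2)); definedness of
--        (a ⊕ b) ⊕ c is (cw3) after commuting a ⊕ b; associativity is the
--        dual of the product associativity (cw4).

open import Defs
open import Level using (Level)
open import Data.Product using (_×_; _,_; proj₁; proj₂)
open import Relation.Binary.PropositionalEquality
  using (_≡_; sym; trans; cong; subst; subst₂; module ≡-Reasoning)
open import Relation.Binary.Lattice.Structures using (IsBoundedLattice)

module InvolutiveLatticeProperties {c ℓ : Level} (L : BoundedInvolutiveLattice c ℓ) where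
  open BoundedInvolutiveLattice L
  open IsBoundedLattice isBoundedLattice using (antisym; maximum; minimum)

  ≤′-swap : ∀ {a b} → a ≤ b ′ → b ≤ a ′
  ≤′-swap {a} {b} a≤b′ = subst (λ z → z ≤ a ′) (involutive b) (antitone a≤b′)

  𝟘′≡𝟙 : 𝟘 ′ ≡ 𝟙
  𝟘′≡𝟙 = antisym (maximum (𝟘 ′)) (≤′-swap (minimum (𝟙 ′)))

  𝟙′≡𝟘 : 𝟙 ′ ≡ 𝟘
  𝟙′≡𝟘 = trans (cong _′ (sym 𝟘′≡𝟙)) (involutive 𝟘)

module InducedSum {c ℓ : Level} (L : BoundedInvolutiveLattice c ℓ)
                  (_·_ _⇒_ : BoundedInvolutiveLattice.Carrier L →
                             BoundedInvolutiveLattice.Carrier L →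
                             BoundedInvolutiveLattice.Carrier L) where
  open BoundedInvolutiveLattice L
  open IsBoundedLattice isBoundedLattice using (maximum) renaming (trans to ≤-trans)
  open InvolutiveLatticeProperties L

  _⊕_ : Carrier → Carrier → Carrier
  a ⊕ b = (a ′) ⇒ b

  module _ (cw1 : ∀ a b → a · b ≡ (a ⇒ (b ′)) ′) where

    ⊕-dual : ∀ a b → (a ⊕ b) ′ ≡ (a ′) · (b ′)
    ⊕-dual a b = begin
      ((a ′) ⇒ b) ′            ≡⟨ cong (λ z → ((a ′) ⇒ z) ′) (sym (involutive b)) ⟩
      ((a ′) ⇒ ((b ′) ′)) ′    ≡⟨ sym (cw1 (a ′) (b ′)) ⟩
      (a ′) · (b ′)            ∎
      where open ≡-Reasoning

    ⊕-via-· : ∀ a b → a ⊕ b ≡ ((a ′) · (b ′)) ′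
    ⊕-via-· a b = trans (sym (involutive (a ⊕ b))) (cong _′ (⊕-dual a b))

    ⊕-identityʳ : (cw5 : ∀ a → a · 𝟙 ≡ a) → ∀ a → (a ≤ 𝟘 ′) × (a ⊕ 𝟘 ≡ a)
    ⊕-identityʳ cw5 a = subst (a ≤_) (sym 𝟘′≡𝟙) (maximum a) , a⊕𝟘≡a
      where
      open ≡-Reasoning
      a⊕𝟘≡a : a ⊕ 𝟘 ≡ a
      a⊕𝟘≡a = begin
        a ⊕ 𝟘              ≡⟨ ⊕-via-· a 𝟘 ⟩
        ((a ′) · (𝟘 ′)) ′  ≡⟨ cong (λ z → ((a ′) · z) ′) 𝟘′≡𝟙 ⟩
        ((a ′) · 𝟙) ′      ≡⟨ cong _′ (cw5 (a ′)) ⟩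
        (a ′) ′            ≡⟨ involutive a ⟩
        a                  ∎

    ⊕-assoc : (cw4 : ∀ a b c → b ′ ≤ c → a ′ ≤ b · c → a · (b · c) ≡ (a · b) · c) →
              ∀ a b c → b ≤ c ′ → a ≤ (b ⊕ c) ′ → a ⊕ (b ⊕ c) ≡ (a ⊕ b) ⊕ c
    ⊕-assoc cw4 a b c b≤c′ a≤[b⊕c]′ = begin
      a ⊕ (b ⊕ c)                    ≡⟨ ⊕-via-· a (b ⊕ c) ⟩
      ((a ′) · ((b ⊕ c) ′)) ′        ≡⟨ cong (λ z → ((a ′) · z) ′) (⊕-dual b c) ⟩
      ((a ′) · ((b ′) · (c ′))) ′    ≡⟨ cong _′ product-assoc ⟩
      (((a ′) · (b ′)) · (c ′)) ′    ≡⟨ cong (λ z → (z · (c ′)) ′) (sym (⊕-dual a b)) ⟩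
      (((a ⊕ b) ′) · (c ′)) ′        ≡⟨ sym (⊕-via-· (a ⊕ b) c) ⟩
      (a ⊕ b) ⊕ c                    ∎
      where
      open ≡-Reasoning
      product-assoc : (a ′) · ((b ′) · (c ′)) ≡ ((a ′) · (b ′)) · (c ′)
      product-assoc = cw4 (a ′) (b ′) (c ′)
        (subst (_≤ c ′) (sym (involutive b)) b≤c′)
        (subst₂ _≤_ (sym (involutive a)) (⊕-dual b c) a≤[b⊕c]′)

  module _ (cw2 : ∀ a b → a ≤ b ′ → ((a ′) ⇒ b ≡ (b ′) ⇒ a) × (a ≤ (a ′) ⇒ b)) where

    ⊕-comm : ∀ a b → a ≤ b ′ → (b ≤ a ′) × (a ⊕ b ≡ b ⊕ a)
    ⊕-comm a b a≤b′ = ≤′-swap a≤b′ , proj₁ (cw2 a b a≤b′)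

    -- If a ⊕ (b ⊕ c) is defined then so is a ⊕ b, because b ≤ b ⊕ c.
    ⊕-defined-left : ∀ a b c → b ≤ c ′ → a ≤ (b ⊕ c) ′ → a ≤ b ′
    ⊕-defined-left a b c b≤c′ a≤[b⊕c]′ =
      ≤-trans a≤[b⊕c]′ (antitone (proj₂ (cw2 b c b≤c′)))

    -- If a ⊕ (b ⊕ c) is defined then so is (a ⊕ b) ⊕ c: by (cw3) applied to
    -- b ≤ c′, b ≤ a′ and b ⊕ c ≤ a′ we get b ⊕ a ≤ c′, and b ⊕ a = a ⊕ b.
    ⊕-defined-right :
      (cw3 : ∀ a b c → a ≤ b ′ → a ≤ c ′ → (a ′) ⇒ b ≤ c ′ → (a ′) ⇒ c ≤ b ′) →
      ∀ a b c → b ≤ c ′ → a ≤ (b ⊕ c) ′ → a ⊕ b ≤ c ′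
    ⊕-defined-right cw3 a b c b≤c′ a≤[b⊕c]′ =
      subst (_≤ c ′) (sym (proj₂ (⊕-comm a b a≤b′)))
            (cw3 b c a b≤c′ (≤′-swap a≤b′) (≤′-swap a≤[b⊕c]′))
      where
      a≤b′ : a ≤ b ′
      a≤b′ = ⊕-defined-left a b c b≤c′ a≤[b⊕c]′

mainTheorem3 : {c ℓ : Level} (L : BoundedInvolutiveLattice c ℓ) →
    let open BoundedInvolutiveLattice L in
    (_·_ : Carrier → Carrier → Carrier) →
    (_⇒_ : Carrier → Carrier → Carrier) →
    (cw1 : ∀ a b → a · b ≡ (a ⇒ (b ′)) ′) →
    (cw2 : ∀ a b → a ≤ b ′ → ((a ′) ⇒ b ≡ (b ′) ⇒ a) × (a ≤ (a ′) ⇒ b)) →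
    (cw3 : ∀ a b c → a ≤ b ′ → a ≤ c ′ → (a ′) ⇒ b ≤ c ′ → (a ′) ⇒ c ≤ b ′) →
    (cw4 : ∀ a b c → b ′ ≤ c → a ′ ≤ b · c → a · (b · c) ≡ (a · b) · c) →
    (cw5 : ∀ a → a · 𝟙 ≡ a) →
    IsWeakLatticeEffectAlgebra L (λ a b → (a ′) ⇒ b)
mainTheorem3 L _·_ _⇒_ cw1 cw2 cw3 cw4 cw5 = record
  { W1 = ⊕-comm cw2
  ; W2 = λ a b c b≤c′ a≤[b⊕c]′ →
           ⊕-defined-left cw2 a b c b≤c′ a≤[b⊕c]′ ,
           ⊕-defined-right cw2 cw3 a b c b≤c′ a≤[b⊕c]′ ,
           ⊕-assoc cw1 cw4 a b c b≤c′ a≤[b⊕c]′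
  ; W3 = ⊕-identityʳ cw1 cw5
  }
  where open InducedSum L _·_ _⇒_
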